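{- Let a square have rational side length $T>0$ and vertices $A,B,C,D$ in cyclic order, and let $P$ be a point in the plane whose distances $X=|PA|$, $Y=|PB|$, $Z=|PC|$, $U=|PD|$ are all rational. Then $v_3(X)=v_3(Y)=v_3(Z)=v_3(U)<v_3(T)$. In particular, if $X,Y,Z,T,U$ are integers with no common prime factor (a primitive solution, obtained after scaling), then $X,Y,Z,U$ are all nonzero modulo $3$ and $T\equiv 0\pmod 3$.
   Context: For a prime $p$ and a nonzero rational $t=p^k r/s$ with $r,s$ integers coprime to $p$, $v_p(t)=k$; and $v_p(0)=\infty$.
   Formalization: The point $P$ is taken with rational coordinates, in the frame where the square has vertices (0,0), (T,0), (T,T), (0,T). -}

module Defs where

open import Data.Nat as ℕ using (ℕ; _^_)
open import Data.Integer as ℤ using (ℤ; +_)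
open import Data.Integer.Divisibility using () renaming (_∣_ to _∣ℤ_)
open import Data.Nat.Divisibility using (_∣_)
open import Data.Rational as ℚ using (ℚ; _/_)
open import Data.Product using (Σ; ∃; _×_)
open import Relation.Nullary using (¬_)
open import Relation.Binary.PropositionalEquality using (_≡_)

ℤ→ℚ : ℤ → ℚ
ℤ→ℚ z = z / 1

ℕ→ℚ : ℕ → ℚ
ℕ→ℚ n = (+ n) / 1

sq : ℚ → ℚ
sq q = q ℚ.* q

-- HasVal p t k : the rational t is nonzero and v_p(t) = k, i.e.
-- t = p^a r / (p^b s) with r, s integers coprime to p (p ∤ r, p ∤ s) and k = a - b.
-- (Equivalently t = p^k r/s as in the paper; the unique k is v_p(t).)
HasVal : ℕ → ℚ → ℤ → Set
HasVal p t k =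
  Σ ℕ λ a → Σ ℕ λ b → Σ ℤ λ r → Σ ℕ λ s →
    (¬ ((+ p) ∣ℤ r)) × (¬ (p ∣ s)) ×
    (k ≡ (+ a) ℤ.- (+ b)) ×
    (t ℚ.* ℕ→ℚ (p ^ b ℕ.* s) ≡ ℤ→ℚ ((+ (p ^ a)) ℤ.* r))

-- The square of side T (T > 0) placed at A = (0,0), B = (T,0), C = (T,T), D = (0,T)
-- (vertices in cyclic order); P = (x , y).
SquareConfig : (T x y X Y Z U : ℚ) → Set
SquareConfig T x y X Y Z U =
  (ℚ.0ℚ ℚ.≤ X) × (ℚ.0ℚ ℚ.≤ Y) × (ℚ.0ℚ ℚ.≤ Z) × (ℚ.0ℚ ℚ.≤ U) ×
  (sq X ≡ sq x ℚ.+ sq y) ×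
  (sq Y ≡ sq (x ℚ.- T) ℚ.+ sq y) ×
  (sq Z ≡ sq (x ℚ.- T) ℚ.+ sq (y ℚ.- T)) ×
  (sq U ≡ sq x ℚ.+ sq (y ℚ.- T))

{-# OPTIONS --safe #-}
-- Squares are 0 or 1 modulo 3, so in an integral right triangle c² = a² + b² (degenerate ones
-- allowed) some leg is divisible by 3, and 3 ∣ c forces 3 to divide both legs. After clearing
-- denominators, the four triangles with legs x or x − t, y or y − t and hypotenuses X, Y, Z, U
-- force 3 ∣ t. Then either 3 divides x and y, hence all seven numbers, and dividing by 3 we
-- descend on |t|; or it does not, and then 3 divides none of X, Y, Z, U. So the distances share
-- one 3-adic valuation, strictly below that of the side, and dividing by the common denominator
-- shifts all valuations equally. In a primitive solution that common valuation is 0, as otherwise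
-- 3 would divide X, Y, Z, U and T.
module Submission where

open import Defs
open import Data.Nat as ℕ using (ℕ; _%_)
open import Data.Nat.Divisibility using (_∣_)
open import Data.Nat.Primality using (Prime)
open import Data.Integer as ℤ using (ℤ)
open import Data.Rational as ℚ using (ℚ)
open import Data.Product using (Σ; ∃; _×_)
open import Relation.Nullary using (¬_)
open import Relation.Binary.PropositionalEquality using (_≡_; _≢_)

module SquaresMod3 where

  open import Data.Nat
  open import Data.Nat.Properties using (+-comm)
  open import Data.Nat.DivMod using (%-congˡ; %-distribˡ-+; %-distribˡ-*; m%n<n)
  open import Data.Nat.Divisibility
    using (_∣?_; m%n≡0⇒n∣m; n∣m⇒m%n≡0; ∣m⇒∣m*n; ∣m∣n⇒∣m+n; ∣m+n∣m⇒∣n)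
  open import Data.Nat.Primality using (prime?; euclidsLemma)
  open import Data.Empty using (⊥-elim)
  open import Data.Sum using (_⊎_; inj₁; inj₂; [_,_]′)
  open import Data.Product using (_,_)
  open import Function using (id; _∘_)
  open import Relation.Nullary using (yes; no)
  open import Relation.Nullary.Decidable using (from-yes)
  open import Relation.Binary.PropositionalEquality
  open ≡-Reasoning

  prime[3] : Prime 3
  prime[3] = from-yes (prime? 3)

  3∣n*n⇒3∣n : ∀ {n} → 3 ∣ n * n → 3 ∣ n
  3∣n*n⇒3∣n {n} 3∣n*n = [ id , id ]′ (euclidsLemma n n prime[3] 3∣n*n)

  n*n%3≡1 : ∀ n → ¬ 3 ∣ n → (n * n) % 3 ≡ 1
  n*n%3≡1 n 3∤n = begin
    (n * n) % 3             ≡⟨ %-distribˡ-* n n 3 ⟩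
    (n % 3 * (n % 3)) % 3   ≡⟨ unit-squares (n % 3) (m%n<n n 3) (3∤n ∘ m%n≡0⇒n∣m n 3) ⟩
    1                       ∎
    where
    unit-squares : ∀ r → r < 3 → r ≢ 0 → (r * r) % 3 ≡ 1
    unit-squares 0 _ r≢0 = ⊥-elim (r≢0 refl)
    unit-squares 1 _ _   = refl
    unit-squares 2 _ _   = refl
    unit-squares (suc (suc (suc _))) (s≤s (s≤s (s≤s ()))) _

  n*n%3≢2 : ∀ n → (n * n) % 3 ≢ 2
  n*n%3≢2 n eq with 3 ∣? n
  ... | yes 3∣n = 0≢2 (trans (sym (n∣m⇒m%n≡0 (n * n) 3 (∣m⇒∣m*n n 3∣n))) eq)
    where 0≢2 : 0 ≢ 2
          0≢2 ()
  ... | no  3∤n = 1≢2 (trans (sym (n*n%3≡1 n 3∤n)) eq)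
    where 1≢2 : 1 ≢ 2
          1≢2 ()

  3∣leg : ∀ {a b c} → c * c ≡ a * a + b * b → 3 ∣ a ⊎ 3 ∣ b
  3∣leg {a} {b} {c} eq with 3 ∣? a | 3 ∣? b
  ... | yes 3∣a | _       = inj₁ 3∣a
  ... | no _    | yes 3∣b = inj₂ 3∣b
  ... | no 3∤a  | no 3∤b  = ⊥-elim (n*n%3≢2 c (begin
    (c * c) % 3                      ≡⟨ %-congˡ eq ⟩
    (a * a + b * b) % 3              ≡⟨ %-distribˡ-+ (a * a) (b * b) 3 ⟩
    ((a * a) % 3 + (b * b) % 3) % 3  ≡⟨ cong₂ (λ r s → (r + s) % 3) (n*n%3≡1 a 3∤a) (n*n%3≡1 b 3∤b) ⟩
    2                                ∎))

  3∣hyp⇒3∣legs : ∀ {a b c} → c * c ≡ a * a + b * b → 3 ∣ c → 3 ∣ a × 3 ∣ b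
  3∣hyp⇒3∣legs {a} {b} {c} eq 3∣c with 3∣leg {c = c} eq
  ... | inj₁ 3∣a = 3∣a , 3∣n*n⇒3∣n (∣m+n∣m⇒∣n 3∣a*a+b*b (∣m⇒∣m*n a 3∣a))
    where 3∣a*a+b*b = subst (3 ∣_) eq (∣m⇒∣m*n c 3∣c)
  ... | inj₂ 3∣b = 3∣n*n⇒3∣n (∣m+n∣m⇒∣n 3∣b*b+a*a (∣m⇒∣m*n b 3∣b)) , 3∣b
    where 3∣b*b+a*a = subst (3 ∣_) (trans eq (+-comm (a * a) (b * b))) (∣m⇒∣m*n c 3∣c)

  3∣legs⇒3∣hyp : ∀ {a b c} → c * c ≡ a * a + b * b → 3 ∣ a → 3 ∣ b → 3 ∣ c
  3∣legs⇒3∣hyp {a} {b} eq 3∣a 3∣b =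
    3∣n*n⇒3∣n (subst (3 ∣_) (sym eq) (∣m∣n⇒∣m+n (∣m⇒∣m*n a 3∣a) (∣m⇒∣m*n b 3∣b)))

module PythagoreanTriples where

  open import Data.Nat as ℕ using (ℕ)
  open import Data.Integer
  open import Data.Integer.Properties using (+-injective; pos-+; +◃n≡+n; *-cancelʳ-≡; i*j≢0)
  open import Data.Integer.Divisibility.Signed using (∣ᵤ⇒∣; ∣⇒∣ᵤ) renaming (_∣_ to _∣ℤ_)
  import Data.Sign.Properties as Sign
  open import Data.Integer.Solver using (module +-*-Solver)
  open +-*-Solver
  open import Data.Product using (_×_; map)
  open import Data.Sum using (_⊎_; [_,_]′; inj₁; inj₂)
  open import Function using (_$_; _∘_)
  open import Relation.Binary.PropositionalEquality
  open ≡-Reasoning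
  module ℕ3 = SquaresMod3

  record PythagoreanTriple (a b c : ℤ) : Set where
    constructor pythagorean
    field equation : c * c ≡ a * a + b * b

  i*i≡+∣i∣*∣i∣ : ∀ i → i * i ≡ + (∣ i ∣ ℕ.* ∣ i ∣)
  i*i≡+∣i∣*∣i∣ i = trans (cong (_◃ (∣ i ∣ ℕ.* ∣ i ∣)) (Sign.s*s≡+ (sign i))) (+◃n≡+n _)

  pythagorean-∣∣ : ∀ {a b c} → PythagoreanTriple a b c →
                   ∣ c ∣ ℕ.* ∣ c ∣ ≡ ∣ a ∣ ℕ.* ∣ a ∣ ℕ.+ ∣ b ∣ ℕ.* ∣ b ∣
  pythagorean-∣∣ {a} {b} {c} (pythagorean eq) = +-injective (begin
    + (∣ c ∣ ℕ.* ∣ c ∣)                          ≡⟨ i*i≡+∣i∣*∣i∣ c ⟨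
    c * c                                        ≡⟨ eq ⟩
    a * a + b * b                                ≡⟨ cong₂ _+_ (i*i≡+∣i∣*∣i∣ a) (i*i≡+∣i∣*∣i∣ b) ⟩
    + (∣ a ∣ ℕ.* ∣ a ∣) + + (∣ b ∣ ℕ.* ∣ b ∣)    ≡⟨ pos-+ (∣ a ∣ ℕ.* ∣ a ∣) (∣ b ∣ ℕ.* ∣ b ∣) ⟨
    + (∣ a ∣ ℕ.* ∣ a ∣ ℕ.+ ∣ b ∣ ℕ.* ∣ b ∣)      ∎)

  pythagorean-cancel : ∀ {a b c} k .{{_ : NonZero k}} →
                       PythagoreanTriple (a * k) (b * k) (c * k) → PythagoreanTriple a b c
  pythagorean-cancel {a} {b} {c} k (pythagorean eq) =
    pythagorean $ *-cancelʳ-≡ _ _ (k * k) {{i*j≢0 k k}} (begin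
      c * c * (k * k)                     ≡⟨ solve 2 (λ c k → c :* c :* (k :* k) := c :* k :* (c :* k))
                                                     refl c k ⟩
      c * k * (c * k)                     ≡⟨ eq ⟩
      a * k * (a * k) + b * k * (b * k)   ≡⟨ solve 3 (λ a b k → a :* k :* (a :* k) :+ b :* k :* (b :* k)
                                                       := (a :* a :+ b :* b) :* (k :* k)) refl a b k ⟩
      (a * a + b * b) * (k * k)           ∎)

  3∣leg : ∀ {a b c} → PythagoreanTriple a b c → + 3 ∣ℤ a ⊎ + 3 ∣ℤ b
  3∣leg {a} {b} {c} abc =
    [ inj₁ ∘ ∣ᵤ⇒∣ {+ 3} {a} , inj₂ ∘ ∣ᵤ⇒∣ {+ 3} {b} ]′ (ℕ3.3∣leg {c = ∣ c ∣} (pythagorean-∣∣ abc))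

  3∣hyp⇒3∣legs : ∀ {a b c} → PythagoreanTriple a b c → + 3 ∣ℤ c → + 3 ∣ℤ a × + 3 ∣ℤ b
  3∣hyp⇒3∣legs {a} {b} {c} abc 3∣c =
    map (∣ᵤ⇒∣ {+ 3} {a}) (∣ᵤ⇒∣ {+ 3} {b}) (ℕ3.3∣hyp⇒3∣legs {c = ∣ c ∣} (pythagorean-∣∣ abc) (∣⇒∣ᵤ 3∣c))

  3∣legs⇒3∣hyp : ∀ {a b c} → PythagoreanTriple a b c → + 3 ∣ℤ a → + 3 ∣ℤ b → + 3 ∣ℤ c
  3∣legs⇒3∣hyp {c = c} abc 3∣a 3∣b =
    ∣ᵤ⇒∣ {+ 3} {c} (ℕ3.3∣legs⇒3∣hyp (pythagorean-∣∣ abc) (∣⇒∣ᵤ 3∣a) (∣⇒∣ᵤ 3∣b))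

module IntegerValuations where

  open import Data.Nat as ℕ using (ℕ; zero; suc; _^_; _<_; z≤n; s≤s; NonZero; NonTrivial)
  import Data.Nat.Properties as ℕ
  open import Data.Nat.Divisibility using (∣m⇒∣m*n; m∣m*n)
  open import Data.Integer as ℤ using (ℤ; +_; ∣_∣; 0ℤ; _*_)
  import Data.Integer.Properties as ℤ
  open import Data.Integer.Divisibility.Signed using (divides; _∣?_) renaming (_∣_ to _∣ℤ_)
  open import Data.Integer.Solver using (module +-*-Solver)
  open import Data.Empty using (⊥-elim)
  open import Data.Product using (_,_; map)
  open import Function using (_⇔_; mk⇔)
  open import Induction.WellFounded using (Acc; acc)
  open import Data.Nat.Induction using (<-wellFounded)
  open import Relation.Nullary using (yes; no)
  open import Relation.Binary.PropositionalEquality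
  open ≡-Reasoning
  open +-*-Solver

  record HasValℤ (p : ℕ) (z : ℤ) (v : ℕ) : Set where
    constructor hasValℤ
    field
      unit     : ℤ
      unit-eq  : z ≡ + (p ^ v) * unit
      p∤unit   : ¬ (+ p ∣ℤ unit)

  +p^[1+v]≡ : ∀ p v → + (p ^ suc v) ≡ + (p ^ v) * + p
  +p^[1+v]≡ p v = trans (ℤ.pos-* p (p ^ v)) (ℤ.*-comm (+ p) (+ (p ^ v)))

  HasValℤ-0 : ∀ {p z} → ¬ (+ p ∣ℤ z) → HasValℤ p z 0
  HasValℤ-0 {z = z} p∤z = hasValℤ z (sym (ℤ.*-identityˡ z)) p∤z

  HasValℤ-*p : ∀ {p z v} → HasValℤ p z v → HasValℤ p (z * + p) (suc v)
  HasValℤ-*p {p} {v = v} (hasValℤ u refl p∤u) = hasValℤ u (begin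
    + (p ^ v) * u * + p        ≡⟨ solve 3 (λ q u p → q :* u :* p := q :* p :* u) refl (+ (p ^ v)) u (+ p) ⟩
    + (p ^ v) * + p * u        ≡⟨ cong (_* u) (+p^[1+v]≡ p v) ⟨
    + (p ^ suc v) * u          ∎) p∤u

  ∣⇔0<val : ∀ {p z v} → HasValℤ p z v → (+ p ∣ℤ z ⇔ 0 < v)
  ∣⇔0<val {p} {z} {v} (hasValℤ u z≡ p∤u) = mk⇔ (to v z≡) (from v z≡)
    where
    to : ∀ v → z ≡ + (p ^ v) * u → + p ∣ℤ z → 0 < v
    to zero    refl p∣z = ⊥-elim (p∤u (subst (+ p ∣ℤ_) (ℤ.*-identityˡ u) p∣z))
    to (suc v) _    _   = s≤s z≤n
    from : ∀ v → z ≡ + (p ^ v) * u → 0 < v → + p ∣ℤ z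
    from (suc v) refl _ = divides (+ (p ^ v) * u) (begin
      + (p ^ suc v) * u          ≡⟨ cong (_* u) (+p^[1+v]≡ p v) ⟩
      + (p ^ v) * + p * u        ≡⟨ solve 3 (λ q u p → q :* p :* u := q :* u :* p) refl (+ (p ^ v)) u (+ p) ⟩
      + (p ^ v) * u * + p        ∎)

  ∣i∣<∣i*p∣ : ∀ {p} .{{_ : NonTrivial p}} {i} → i ≢ 0ℤ → ∣ i ∣ < ∣ i * + p ∣
  ∣i∣<∣i*p∣ {p} {i} i≢0 =
    subst (∣ i ∣ <_) (sym (ℤ.abs-* i (+ p))) (ℕ.m<m*n ∣ i ∣ p {{ℤ.≢-nonZero i≢0}} (ℕ.nonTrivial⇒n>1 p))

  valuationℤ : ∀ {p} .{{_ : NonTrivial p}} {z} → z ≢ 0ℤ → ∃ (HasValℤ p z)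
  valuationℤ {p} {z} = go z (<-wellFounded ∣ z ∣)
    where
    go : ∀ z → Acc _<_ ∣ z ∣ → z ≢ 0ℤ → ∃ (HasValℤ p z)
    go z (acc rec) z≢0 with + p ∣? z
    ... | no  p∤z              = 0 , HasValℤ-0 p∤z
    ... | yes (divides q refl) = map suc HasValℤ-*p (go q (rec (∣i∣<∣i*p∣ q≢0)) q≢0)
      where
      q≢0 : q ≢ 0ℤ
      q≢0 refl = z≢0 refl

  p-adic-exponent-unique : ∀ {p} .{{_ : NonZero p}} m n {u w} →
                           p ^ m ℕ.* u ≡ p ^ n ℕ.* w → ¬ (p ∣ u) → ¬ (p ∣ w) → m ≡ n
  p-adic-exponent-unique         zero    zero    _  _   _   = refl
  p-adic-exponent-unique {p}     zero    (suc n) {u} {w} eq p∤u _ =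
    ⊥-elim (p∤u (subst (p ∣_) (trans (sym eq) (ℕ.*-identityˡ u)) (∣m⇒∣m*n w (m∣m*n (p ^ n)))))
  p-adic-exponent-unique {p}     (suc m) zero    {u} {w} eq _ p∤w =
    ⊥-elim (p∤w (subst (p ∣_) (trans eq (ℕ.*-identityˡ w)) (∣m⇒∣m*n u (m∣m*n (p ^ m)))))
  p-adic-exponent-unique {p}     (suc m) (suc n) {u} {w} eq p∤u p∤w =
    cong suc (p-adic-exponent-unique m n (ℕ.*-cancelˡ-≡ _ _ p (begin
      p ℕ.* (p ^ m ℕ.* u)   ≡⟨ ℕ.*-assoc p (p ^ m) u ⟨
      p ^ suc m ℕ.* u       ≡⟨ eq ⟩
      p ^ suc n ℕ.* w       ≡⟨ ℕ.*-assoc p (p ^ n) w ⟩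
      p ℕ.* (p ^ n ℕ.* w)   ∎)) p∤u p∤w)

module Descent where

  open import Data.Nat as ℕ using (ℕ; _<_; s≤s)
  open import Data.Nat.Induction using (<-wellFounded)
  open import Data.Integer as ℤ using (ℤ; +_; ∣_∣; 0ℤ; _-_; _*_)
  open import Data.Integer.Divisibility.Signed
    using (divides; _∣?_; ∣m∣n⇒∣m-n; ∣m∣n⇒∣m+n) renaming (_∣_ to _∣ℤ_)
  open import Data.Integer.Solver using (module +-*-Solver)
  open import Data.Product using (_,_; map; map₁; map₂)
  open import Data.Sum using (inj₁; inj₂; [_,_]′)
  open import Function using (Equivalence)
  open import Induction.WellFounded using (Acc; acc)
  open import Relation.Nullary using (yes; no)
  open import Relation.Nullary.Decidable using (_×-dec_)
  open import Relation.Binary.PropositionalEquality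
  open +-*-Solver
  open PythagoreanTriples
  open IntegerValuations

  ∣m∣m-n⇒∣n : ∀ {d m n} → d ∣ℤ m → d ∣ℤ m - n → d ∣ℤ n
  ∣m∣m-n⇒∣n {m = m} {n} d∣m d∣m-n =
    subst (_ ∣ℤ_) (solve 2 (λ m n → m :- (m :- n) := n) refl m n) (∣m∣n⇒∣m-n d∣m d∣m-n)

  ∣n∣m-n⇒∣m : ∀ {d m n} → d ∣ℤ n → d ∣ℤ m - n → d ∣ℤ m
  ∣n∣m-n⇒∣m {m = m} {n} d∣n d∣m-n =
    subst (_ ∣ℤ_) (solve 2 (λ m n → (m :- n) :+ n := m) refl m n) (∣m∣n⇒∣m+n d∣m-n d∣n)

  record SquareConfigℤ (t x y X Y Z U : ℤ) : Set where
    constructor squareConfigℤ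
    field
      PA : PythagoreanTriple x y X
      PB : PythagoreanTriple (x - t) y Y
      PC : PythagoreanTriple (x - t) (y - t) Z
      PD : PythagoreanTriple x (y - t) U

  SquareConfigℤ-cancel : ∀ {t x y X Y Z U} k .{{_ : ℤ.NonZero k}} →
    SquareConfigℤ (t * k) (x * k) (y * k) (X * k) (Y * k) (Z * k) (U * k) → SquareConfigℤ t x y X Y Z U
  SquareConfigℤ-cancel {t} {x} {y} k (squareConfigℤ PA PB PC PD) = squareConfigℤ
    (pythagorean-cancel k PA)
    (pythagorean-cancel k (subst (λ a → PythagoreanTriple a _ _) (*-distribʳ-- x) PB))
    (pythagorean-cancel k (subst₂ (λ a b → PythagoreanTriple a b _) (*-distribʳ-- x) (*-distribʳ-- y) PC))
    (pythagorean-cancel k (subst (λ b → PythagoreanTriple _ b _) (*-distribʳ-- y) PD))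
    where
    *-distribʳ-- : ∀ a → a * k - t * k ≡ (a - t) * k
    *-distribʳ-- a = solve 3 (λ a t k → a :* k :- t :* k := (a :- t) :* k) refl a t k

  3∣side : ∀ {t x y X Y Z U} → SquareConfigℤ t x y X Y Z U → + 3 ∣ℤ t
  3∣side (squareConfigℤ PA PB PC PD) with 3∣leg PA | 3∣leg PC
  ... | inj₁ 3∣x | inj₁ 3∣x-t = ∣m∣m-n⇒∣n 3∣x 3∣x-t
  ... | inj₂ 3∣y | inj₂ 3∣y-t = ∣m∣m-n⇒∣n 3∣y 3∣y-t
  ... | inj₁ 3∣x | inj₂ 3∣y-t = [ ∣m∣m-n⇒∣n 3∣x , (λ 3∣y → ∣m∣m-n⇒∣n 3∣y 3∣y-t) ]′ (3∣leg PB)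
  ... | inj₂ 3∣y | inj₁ 3∣x-t = [ (λ 3∣x → ∣m∣m-n⇒∣n 3∣x 3∣x-t) , ∣m∣m-n⇒∣n 3∣y ]′ (3∣leg PD)

  3∤hypotenuses : ∀ {t x y X Y Z U} → SquareConfigℤ t x y X Y Z U → ¬ (+ 3 ∣ℤ x × + 3 ∣ℤ y) →
                  ¬ (+ 3 ∣ℤ X) × ¬ (+ 3 ∣ℤ Y) × ¬ (+ 3 ∣ℤ Z) × ¬ (+ 3 ∣ℤ U)
  3∤hypotenuses cfg@(squareConfigℤ PA PB PC PD) 3∤x,y =
    (λ 3∣X → 3∤x,y (3∣hyp⇒3∣legs PA 3∣X)) ,
    (λ 3∣Y → 3∤x,y (map₁ (∣n∣m-n⇒∣m 3∣t) (3∣hyp⇒3∣legs PB 3∣Y))) ,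
    (λ 3∣Z → 3∤x,y (map (∣n∣m-n⇒∣m 3∣t) (∣n∣m-n⇒∣m 3∣t) (3∣hyp⇒3∣legs PC 3∣Z))) ,
    (λ 3∣U → 3∤x,y (map₂ (∣n∣m-n⇒∣m 3∣t) (3∣hyp⇒3∣legs PD 3∣U)))
    where 3∣t = 3∣side cfg

  3∣hypotenuses : ∀ {t x y X Y Z U} → SquareConfigℤ t x y X Y Z U → + 3 ∣ℤ x → + 3 ∣ℤ y →
                  + 3 ∣ℤ X × + 3 ∣ℤ Y × + 3 ∣ℤ Z × + 3 ∣ℤ U
  3∣hypotenuses cfg@(squareConfigℤ PA PB PC PD) 3∣x 3∣y =
    3∣legs⇒3∣hyp PA 3∣x 3∣y ,
    3∣legs⇒3∣hyp PB 3∣x-t 3∣y ,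
    3∣legs⇒3∣hyp PC 3∣x-t 3∣y-t ,
    3∣legs⇒3∣hyp PD 3∣x 3∣y-t
    where
    3∣x-t = ∣m∣n⇒∣m-n 3∣x (3∣side cfg)
    3∣y-t = ∣m∣n⇒∣m-n 3∣y (3∣side cfg)

  record DistanceValuations (t X Y Z U : ℤ) : Set where
    constructor distanceValuations
    field
      {k m}  : ℕ
      X-val  : HasValℤ 3 X k
      Y-val  : HasValℤ 3 Y k
      Z-val  : HasValℤ 3 Z k
      U-val  : HasValℤ 3 U k
      t-val  : HasValℤ 3 t m
      k<m    : k < m

  DistanceValuations-*3 : ∀ {t X Y Z U} → DistanceValuations t X Y Z U →
                          DistanceValuations (t * + 3) (X * + 3) (Y * + 3) (Z * + 3) (U * + 3)
  DistanceValuations-*3 (distanceValuations X-val Y-val Z-val U-val t-val k<m) = distanceValuations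
    (HasValℤ-*p X-val) (HasValℤ-*p Y-val) (HasValℤ-*p Z-val) (HasValℤ-*p U-val) (HasValℤ-*p t-val) (s≤s k<m)

  descent : ∀ {t x y X Y Z U} → SquareConfigℤ t x y X Y Z U → t ≢ 0ℤ → DistanceValuations t X Y Z U
  descent {t} = go (<-wellFounded ∣ t ∣)
    where
    go : ∀ {t x y X Y Z U} → Acc _<_ ∣ t ∣ →
         SquareConfigℤ t x y X Y Z U → t ≢ 0ℤ → DistanceValuations t X Y Z U
    go {x = x} {y} (acc rec) cfg t≢0 with + 3 ∣? x ×-dec + 3 ∣? y
    ... | no 3∤x,y with 3∤hypotenuses cfg 3∤x,y | valuationℤ t≢0
    ...   | 3∤X , 3∤Y , 3∤Z , 3∤U | m , t-val = distanceValuations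
      (HasValℤ-0 3∤X) (HasValℤ-0 3∤Y) (HasValℤ-0 3∤Z) (HasValℤ-0 3∤U) t-val
      (Equivalence.to (∣⇔0<val t-val) (3∣side cfg))
    go (acc rec) cfg t≢0 | yes (3∣x , 3∣y) with 3∣hypotenuses cfg 3∣x 3∣y
    ... | 3∣X , 3∣Y , 3∣Z , 3∣U
      with 3∣side cfg | 3∣x | 3∣y | 3∣X | 3∣Y | 3∣Z | 3∣U
    ... | divides t′ refl | divides x′ refl | divides y′ refl | divides X′ refl | divides Y′ refl
        | divides Z′ refl | divides U′ refl =
      DistanceValuations-*3 (go (rec (∣i∣<∣i*p∣ t′≢0)) cfg′ t′≢0)
      where
      cfg′ : SquareConfigℤ t′ x′ y′ X′ Y′ Z′ U′
      cfg′ = SquareConfigℤ-cancel (+ 3) cfg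
      t′≢0 : t′ ≢ 0ℤ
      t′≢0 refl = t≢0 refl

module Fractions where

  open import Data.Nat as ℕ using (ℕ)
  import Data.Nat.Properties as ℕ
  open import Data.Nat.DivMod using (_/_; m/n*n≡m)
  open import Data.Nat.ListAction using (product)
  open import Data.Integer as ℤ using (ℤ; +_; 0ℤ)
  import Data.Integer.Properties as ℤ
  import Data.Integer.Solver
  open import Data.Integer.GCD using (gcd)
  open import Data.Rational as ℚ using (ℚ; ↥_; ↧_; ↧ₙ_; toℚᵘ; 0ℚ)
  import Data.Rational.Properties as ℚ
  open import Data.Rational.Unnormalised as ℚᵘ using (mkℚᵘ; *≡*)
  import Data.Rational.Unnormalised.Properties as ℚᵘ
  import Data.Rational.Solver
  open import Data.List using (List; []; _∷_; map)
  open import Data.List.Membership.Propositional using (_∈_)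
  open import Data.List.Membership.Propositional.Properties using (∈-map⁺)
  open import Data.Nat.ListAction.Properties using (∈⇒∣product)
  open import Data.Sum using (_⊎_)
  open import Data.Product using (_,_)
  open import Function using (_∘_)
  import Data.Sum as Sum
  open import Relation.Binary.PropositionalEquality
  open PythagoreanTriples using (PythagoreanTriple; pythagorean)
  open Descent using (SquareConfigℤ; squareConfigℤ)
  private
    module ℤ-Solver = Data.Integer.Solver.+-*-Solver
    module ℚ-Solver = Data.Rational.Solver.+-*-Solver

  toℚᵘ-ℤ→ℚ : ∀ z → toℚᵘ (ℤ→ℚ z) ℚᵘ.≃ mkℚᵘ z 0
  toℚᵘ-ℤ→ℚ z = ℚ.toℚᵘ-fromℚᵘ (mkℚᵘ z 0)

  ℤ→ℚ-injective : ∀ {a b} → ℤ→ℚ a ≡ ℤ→ℚ b → a ≡ b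
  ℤ→ℚ-injective {a} {b} eq = ℤ.*-cancelʳ-≡ a b (+ 1) (ℚᵘ.drop-*≡* (begin
    mkℚᵘ a 0          ≈⟨ toℚᵘ-ℤ→ℚ a ⟨
    toℚᵘ (ℤ→ℚ a)      ≡⟨ cong toℚᵘ eq ⟩
    toℚᵘ (ℤ→ℚ b)      ≈⟨ toℚᵘ-ℤ→ℚ b ⟩
    mkℚᵘ b 0          ∎))
    where open ℚᵘ.≃-Reasoning

  ℤ→ℚ-+ : ∀ a b → ℤ→ℚ (a ℤ.+ b) ≡ ℤ→ℚ a ℚ.+ ℤ→ℚ b
  ℤ→ℚ-+ a b = ℚ.toℚᵘ-injective (begin
    toℚᵘ (ℤ→ℚ (a ℤ.+ b))               ≈⟨ toℚᵘ-ℤ→ℚ (a ℤ.+ b) ⟩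
    mkℚᵘ (a ℤ.+ b) 0                    ≈⟨ *≡* (solve 2 (λ a b → (a :+ b) :* con (+ 1)
                                             := (a :* con (+ 1) :+ b :* con (+ 1)) :* con (+ 1)) refl a b) ⟩
    mkℚᵘ a 0 ℚᵘ.+ mkℚᵘ b 0             ≈⟨ ℚᵘ.+-cong (toℚᵘ-ℤ→ℚ a) (toℚᵘ-ℤ→ℚ b) ⟨
    toℚᵘ (ℤ→ℚ a) ℚᵘ.+ toℚᵘ (ℤ→ℚ b)     ≈⟨ ℚ.toℚᵘ-homo-+ (ℤ→ℚ a) (ℤ→ℚ b) ⟨
    toℚᵘ (ℤ→ℚ a ℚ.+ ℤ→ℚ b)             ∎)
    where
    open ℚᵘ.≃-Reasoning
    open ℤ-Solver

  ℤ→ℚ-* : ∀ a b → ℤ→ℚ (a ℤ.* b) ≡ ℤ→ℚ a ℚ.* ℤ→ℚ b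
  ℤ→ℚ-* a b = ℚ.toℚᵘ-injective (begin
    toℚᵘ (ℤ→ℚ (a ℤ.* b))               ≈⟨ toℚᵘ-ℤ→ℚ (a ℤ.* b) ⟩
    mkℚᵘ a 0 ℚᵘ.* mkℚᵘ b 0             ≈⟨ ℚᵘ.*-cong (toℚᵘ-ℤ→ℚ a) (toℚᵘ-ℤ→ℚ b) ⟨
    toℚᵘ (ℤ→ℚ a) ℚᵘ.* toℚᵘ (ℤ→ℚ b)     ≈⟨ ℚ.toℚᵘ-homo-* (ℤ→ℚ a) (ℤ→ℚ b) ⟨
    toℚᵘ (ℤ→ℚ a ℚ.* ℤ→ℚ b)             ∎)
    where open ℚᵘ.≃-Reasoning

  ℤ→ℚ-neg : ∀ a → ℤ→ℚ (ℤ.- a) ≡ ℚ.- ℤ→ℚ a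
  ℤ→ℚ-neg a = ℚ.toℚᵘ-injective (begin
    toℚᵘ (ℤ→ℚ (ℤ.- a))                 ≈⟨ toℚᵘ-ℤ→ℚ (ℤ.- a) ⟩
    ℚᵘ.- mkℚᵘ a 0                       ≈⟨ ℚᵘ.-‿cong (toℚᵘ-ℤ→ℚ a) ⟨
    ℚᵘ.- toℚᵘ (ℤ→ℚ a)                   ≈⟨ ℚ.toℚᵘ-homo‿- (ℤ→ℚ a) ⟨
    toℚᵘ (ℚ.- ℤ→ℚ a)                    ∎)
    where open ℚᵘ.≃-Reasoning

  record Numerator (D : ℕ) (q : ℚ) (n : ℤ) : Set where
    constructor numerator
    field equation : q ℚ.* ℕ→ℚ D ≡ ℤ→ℚ n

  Numerator-multiple : ∀ q c → Numerator (c ℕ.* ↧ₙ q) q (↥ q ℤ.* + c)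
  Numerator-multiple q@record{} c = numerator (ℚ.toℚᵘ-injective (begin
    toℚᵘ (q ℚ.* ℕ→ℚ (c ℕ.* ↧ₙ q))            ≈⟨ ℚ.toℚᵘ-homo-* q (ℕ→ℚ (c ℕ.* ↧ₙ q)) ⟩
    toℚᵘ q ℚᵘ.* toℚᵘ (ℕ→ℚ (c ℕ.* ↧ₙ q))      ≈⟨ ℚᵘ.*-congˡ {toℚᵘ q} (toℚᵘ-ℤ→ℚ (+ (c ℕ.* ↧ₙ q))) ⟩
    toℚᵘ q ℚᵘ.* mkℚᵘ (+ (c ℕ.* ↧ₙ q)) 0      ≈⟨ *≡* cross-multiplied ⟩
    mkℚᵘ (↥ q ℤ.* + c) 0                      ≈⟨ toℚᵘ-ℤ→ℚ (↥ q ℤ.* + c) ⟨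
    toℚᵘ (ℤ→ℚ (↥ q ℤ.* + c))                  ∎))
    where
    open ℚᵘ.≃-Reasoning
    open ℤ-Solver
    cross-multiplied : ↥ q ℤ.* + (c ℕ.* ↧ₙ q) ℤ.* + 1 ≡ ↥ q ℤ.* + c ℤ.* + (↧ₙ q ℕ.* 1)
    cross-multiplied = trans (cong (λ k → ↥ q ℤ.* k ℤ.* + 1) (ℤ.pos-* c (↧ₙ q)))
      (trans (solve 3 (λ n c d → n :* (c :* d) :* con (+ 1) := n :* c :* (d :* con (+ 1)))
                      refl (↥ q) (+ c) (+ ↧ₙ q))
             (cong (λ k → ↥ q ℤ.* + c ℤ.* k) (sym (ℤ.pos-* (↧ₙ q) 1))))

  p*q≡0⇒p≡0∨q≡0 : ∀ p q → p ℚ.* q ≡ 0ℚ → p ≡ 0ℚ ⊎ q ≡ 0ℚ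
  p*q≡0⇒p≡0∨q≡0 p q pq≡0 = Sum.map (ℚ.↥p≡0⇒p≡0 p) (ℚ.↥p≡0⇒p≡0 q) (ℤ.i*j≡0⇒i≡0∨j≡0 (↥ p) (begin
    ↥ p ℤ.* ↥ q                  ≡⟨ ℚ.↥-* p q ⟨
    ↥ (p ℚ.* q) ℤ.* g            ≡⟨ cong (λ r → ↥ r ℤ.* g) pq≡0 ⟩
    0ℤ ℤ.* g                     ≡⟨ ℤ.*-zeroˡ g ⟩
    0ℤ                           ∎))
    where
    open ≡-Reasoning
    g = gcd (↥ p ℤ.* ↥ q) (↧ p ℤ.* ↧ q)

  Numerator-≢0 : ∀ {D q n} → Numerator D q n → D ≢ 0 → q ≢ 0ℚ → n ≢ 0ℤ
  Numerator-≢0 {D} {q} (numerator qD≡n) D≢0 q≢0 n≡0 =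
    Sum.[ q≢0 , D≢0 ∘ ℤ.+-injective ∘ ℤ→ℚ-injective ]′ (p*q≡0⇒p≡0∨q≡0 q (ℕ→ℚ D) (trans qD≡n (cong ℤ→ℚ n≡0)))

  numeratorOver : ℕ → ℚ → ℤ
  numeratorOver D q = ↥ q ℤ.* + (D / ↧ₙ q)

  numeratorOver-correct : ∀ {D q} → ↧ₙ q ∣ D → Numerator D q (numeratorOver D q)
  numeratorOver-correct {D} {q} ↧q∣D =
    subst (λ E → Numerator E q (numeratorOver D q)) (m/n*n≡m ↧q∣D) (Numerator-multiple q (D / ↧ₙ q))

  Numerator-- : ∀ {D a b m n} → Numerator D a m → Numerator D b n → Numerator D (a ℚ.- b) (m ℤ.- n)
  Numerator-- {D} {a} {b} {m} {n} (numerator am) (numerator bn) = numerator (begin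
    (a ℚ.- b) ℚ.* d               ≡⟨ solve 3 (λ a b d → (a :- b) :* d := a :* d :- b :* d) refl a b d ⟩
    a ℚ.* d ℚ.- b ℚ.* d           ≡⟨ cong₂ ℚ._-_ am bn ⟩
    ℤ→ℚ m ℚ.- ℤ→ℚ n               ≡⟨ cong (ℤ→ℚ m ℚ.+_) (ℤ→ℚ-neg n) ⟨
    ℤ→ℚ m ℚ.+ ℤ→ℚ (ℤ.- n)         ≡⟨ ℤ→ℚ-+ m (ℤ.- n) ⟨
    ℤ→ℚ (m ℤ.- n)                 ∎)
    where
    open ≡-Reasoning
    open ℚ-Solver
    d = ℕ→ℚ D

  Numerator-pythagorean : ∀ {D a b c i j k} → Numerator D a i → Numerator D b j → Numerator D c k →
                          sq c ≡ sq a ℚ.+ sq b → PythagoreanTriple i j k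
  Numerator-pythagorean {D} {a} {b} {c} {i} {j} {k} (numerator ai) (numerator bj) (numerator ck) c²≡a²+b² =
    pythagorean (ℤ→ℚ-injective (begin
      ℤ→ℚ (k ℤ.* k)                                ≡⟨ ℤ→ℚ-* k k ⟩
      ℤ→ℚ k ℚ.* ℤ→ℚ k                              ≡⟨ cong₂ ℚ._*_ ck ck ⟨
      c ℚ.* d ℚ.* (c ℚ.* d)                      ≡⟨ solve 2 (λ c d → c :* d :* (c :* d) := c :* c :* (d :* d))
                                                            refl c d ⟩
      c ℚ.* c ℚ.* (d ℚ.* d)                      ≡⟨ cong (ℚ._* (d ℚ.* d)) c²≡a²+b² ⟩
      (a ℚ.* a ℚ.+ b ℚ.* b) ℚ.* (d ℚ.* d)        ≡⟨ solve 3 (λ a b d → (a :* a :+ b :* b) :* (d :* d)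
                                                       := a :* d :* (a :* d) :+ b :* d :* (b :* d)) refl a b d ⟩
      a ℚ.* d ℚ.* (a ℚ.* d) ℚ.+
        b ℚ.* d ℚ.* (b ℚ.* d)                    ≡⟨ cong₂ ℚ._+_ (cong₂ ℚ._*_ ai ai) (cong₂ ℚ._*_ bj bj) ⟩
      ℤ→ℚ i ℚ.* ℤ→ℚ i ℚ.+ ℤ→ℚ j ℚ.* ℤ→ℚ j        ≡⟨ cong₂ ℚ._+_ (ℤ→ℚ-* i i) (ℤ→ℚ-* j j) ⟨
      ℤ→ℚ (i ℤ.* i) ℚ.+ ℤ→ℚ (j ℤ.* j)            ≡⟨ ℤ→ℚ-+ (i ℤ.* i) (j ℤ.* j) ⟨
      ℤ→ℚ (i ℤ.* i ℤ.+ j ℤ.* j)                  ∎))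
    where
    open ≡-Reasoning
    open ℚ-Solver
    d = ℕ→ℚ D

  commonDenominator : List ℚ → ℕ
  commonDenominator qs = product (map ↧ₙ_ qs)

  commonDenominator-≢0 : ∀ qs → commonDenominator qs ≢ 0
  commonDenominator-≢0 []       ()
  commonDenominator-≢0 (q ∷ qs) D≡0 = Sum.[ (λ ()) , commonDenominator-≢0 qs ]′ (ℕ.m*n≡0⇒m≡0∨n≡0 (↧ₙ q) D≡0)

  ↧ₙ∣commonDenominator : ∀ {q qs} → q ∈ qs → ↧ₙ q ∣ commonDenominator qs
  ↧ₙ∣commonDenominator q∈qs = ∈⇒∣product (∈-map⁺ ↧ₙ_ q∈qs)

  SquareConfigℤ-numerators : ∀ {D T x y X Y Z U t x′ y′ X′ Y′ Z′ U′} →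
    Numerator D T t → Numerator D x x′ → Numerator D y y′ →
    Numerator D X X′ → Numerator D Y Y′ → Numerator D Z Z′ → Numerator D U U′ →
    SquareConfig T x y X Y Z U → SquareConfigℤ t x′ y′ X′ Y′ Z′ U′
  SquareConfigℤ-numerators ⟦T⟧ ⟦x⟧ ⟦y⟧ ⟦X⟧ ⟦Y⟧ ⟦Z⟧ ⟦U⟧ (_ , _ , _ , _ , PA , PB , PC , PD) = squareConfigℤ
    (Numerator-pythagorean ⟦x⟧ ⟦y⟧ ⟦X⟧ PA)
    (Numerator-pythagorean ⟦x-T⟧ ⟦y⟧ ⟦Y⟧ PB)
    (Numerator-pythagorean ⟦x-T⟧ ⟦y-T⟧ ⟦Z⟧ PC)
    (Numerator-pythagorean ⟦x⟧ ⟦y-T⟧ ⟦U⟧ PD)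
    where
    ⟦x-T⟧ = Numerator-- ⟦x⟧ ⟦T⟧
    ⟦y-T⟧ = Numerator-- ⟦y⟧ ⟦T⟧

  ℕ→ℚ-≢0 : ∀ {n} → 0 ℕ.< n → ℕ→ℚ n ≢ 0ℚ
  ℕ→ℚ-≢0 {n} 0<n = ℕ.<⇒≢ 0<n ∘ sym ∘ ℤ.+-injective ∘ ℤ→ℚ-injective {+ n} {+ 0}

module RationalValuations where

  open import Data.Nat as ℕ using (ℕ; NonZero)
  import Data.Nat.Properties as ℕ
  open import Data.Nat.Divisibility using (_∣0)
  open import Data.Nat.Primality using (euclidsLemma; prime⇒nonZero; prime⇒nonTrivial)
  open import Data.Integer as ℤ using (ℤ; +_; 0ℤ; ∣_∣)
  import Data.Integer.Properties as ℤ
  open import Data.Integer.Divisibility.Signed using (∣ᵤ⇒∣; ∣⇒∣ᵤ)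
  import Data.Integer.Solver
  import Data.Nat.Solver
  import Data.Rational.Properties as ℚ
  open import Data.Product using (_,_; proj₁; proj₂)
  open import Data.Sum using ([_,_]′)
  open import Function using (_∘_; _⇔_; mk⇔; Equivalence)
  open import Relation.Binary.PropositionalEquality
  open IntegerValuations
  open Fractions
  module ℤ-Solver = Data.Integer.Solver.+-*-Solver
  module ℕ-Solver = Data.Nat.Solver.+-*-Solver

  HasVal-Numerator : ∀ {p D q n e a} → Numerator D q n → HasValℤ p (+ D) e → HasValℤ p n a →
                     HasVal p q (+ a ℤ.- + e)
  HasVal-Numerator {p} {D} {q} {e = e} {a} (numerator qD≡n) (hasValℤ s D≡ p∤s) (hasValℤ r refl p∤r) =
    a , e , r , ∣ s ∣ , p∤r ∘ ∣ᵤ⇒∣ {+ p} {r} , p∤s ∘ ∣ᵤ⇒∣ {+ p} {s} , refl ,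
    subst (λ E → q ℚ.* ℕ→ℚ E ≡ ℤ→ℚ (+ (p ℕ.^ a) ℤ.* r)) (trans (cong ∣_∣ D≡) (ℤ.abs-* (+ (p ℕ.^ e)) s)) qD≡n

  HasVal-≢0 : ∀ {p t k} .{{_ : NonZero p}} → HasVal p t k → t ≢ ℚ.0ℚ
  HasVal-≢0 {p} (a , b , r , s , p∤r , _ , _ , eq) refl =
    [ ℕ.≢-nonZero⁻¹ (p ℕ.^ a) {{ℕ.m^n≢0 p a}} ∘ ℤ.+-injective
    , (λ r≡0 → p∤r (subst (λ r → p ∣ ∣ r ∣) (sym r≡0) (p ∣0)))
    ]′ (ℤ.i*j≡0⇒i≡0∨j≡0 (+ (p ℕ.^ a)) p^a*r≡0)
    where
    p^a*r≡0 : + (p ℕ.^ a) ℤ.* r ≡ 0ℤ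
    p^a*r≡0 = ℤ→ℚ-injective (trans (sym eq) (ℚ.*-zeroˡ (ℕ→ℚ (p ℕ.^ b ℕ.* s))))

  HasVal-ℕ : ∀ {p} N {k} → Prime p → HasVal p (ℕ→ℚ N) k → ∃ λ v → HasValℤ p (+ N) v × k ≡ + v
  HasVal-ℕ {p} N pp hv@(a , b , r , s , p∤r , p∤s , refl , eq) = v , N-val , k≡v
    where
    open ≡-Reasoning
    instance
      _ = prime⇒nonZero pp
      _ = prime⇒nonTrivial pp
    N-valuation = valuationℤ (HasVal-≢0 {t = ℕ→ℚ N} hv ∘ cong ℤ→ℚ)
    v = proj₁ N-valuation
    N-val = proj₂ N-valuation
    open HasValℤ N-val
    p^[v+b]*[u*s]≡p^a*∣r∣ : p ℕ.^ (v ℕ.+ b) ℕ.* (∣ unit ∣ ℕ.* s) ≡ p ℕ.^ a ℕ.* ∣ r ∣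
    p^[v+b]*[u*s]≡p^a*∣r∣ = begin
      p ℕ.^ (v ℕ.+ b) ℕ.* (∣ unit ∣ ℕ.* s)      ≡⟨ cong (ℕ._* (∣ unit ∣ ℕ.* s)) (ℕ.^-distribˡ-+-* p v b) ⟩
      p ℕ.^ v ℕ.* p ℕ.^ b ℕ.* (∣ unit ∣ ℕ.* s)  ≡⟨ ℕ-Solver.solve 4
                                                      (λ P Q u s → P :* Q :* (u :* s) := P :* u :* (Q :* s))
                                                      refl (p ℕ.^ v) (p ℕ.^ b) ∣ unit ∣ s ⟩
      p ℕ.^ v ℕ.* ∣ unit ∣ ℕ.* (p ℕ.^ b ℕ.* s)  ≡⟨ cong (ℕ._* (p ℕ.^ b ℕ.* s)) N≡p^v*∣u∣ ⟨
      N ℕ.* (p ℕ.^ b ℕ.* s)                     ≡⟨ ℤ.abs-* (+ N) (+ (p ℕ.^ b ℕ.* s)) ⟨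
      ∣ + N ℤ.* + (p ℕ.^ b ℕ.* s) ∣             ≡⟨ cong ∣_∣ N*p^b*s≡p^a*r ⟩
      ∣ + (p ℕ.^ a) ℤ.* r ∣                     ≡⟨ ℤ.abs-* (+ (p ℕ.^ a)) r ⟩
      p ℕ.^ a ℕ.* ∣ r ∣                         ∎
      where
      open ℕ-Solver using (_:*_; _:=_)
      N≡p^v*∣u∣ = trans (cong ∣_∣ unit-eq) (ℤ.abs-* (+ (p ℕ.^ v)) unit)
      N*p^b*s≡p^a*r : + N ℤ.* + (p ℕ.^ b ℕ.* s) ≡ + (p ℕ.^ a) ℤ.* r
      N*p^b*s≡p^a*r = ℤ→ℚ-injective (trans (ℤ→ℚ-* (+ N) (+ (p ℕ.^ b ℕ.* s))) eq)
    v+b≡a : v ℕ.+ b ≡ a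
    v+b≡a = p-adic-exponent-unique (v ℕ.+ b) a p^[v+b]*[u*s]≡p^a*∣r∣
      ([ p∤unit ∘ ∣ᵤ⇒∣ {+ p} {unit} , p∤s ]′ ∘ euclidsLemma ∣ unit ∣ s pp) p∤r
    k≡v : + a ℤ.- + b ≡ + v
    k≡v = begin
      + a ℤ.- + b               ≡⟨ cong (λ c → + c ℤ.- + b) v+b≡a ⟨
      + (v ℕ.+ b) ℤ.- + b       ≡⟨ cong (ℤ._- + b) (ℤ.pos-+ v b) ⟩
      + v ℤ.+ + b ℤ.- + b       ≡⟨ solve 2 (λ v b → v :+ b :- b := v) refl (+ v) (+ b) ⟩
      + v                       ∎
      where open ℤ-Solver

  HasVal-ℕ-nonneg : ∀ {p} N {k} → Prime p → HasVal p (ℕ→ℚ N) k → 0ℤ ℤ.≤ k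
  HasVal-ℕ-nonneg N pp N-val with HasVal-ℕ N pp N-val
  ... | _ , _ , refl = ℤ.+≤+ ℕ.z≤n

  HasVal-ℕ-∣⇔ : ∀ {p} N {k} → Prime p → HasVal p (ℕ→ℚ N) k → (p ∣ N ⇔ 0ℤ ℤ.< k)
  HasVal-ℕ-∣⇔ {p} N pp hv with HasVal-ℕ N pp hv
  ... | v , N-val , refl = mk⇔ (ℤ.+<+ ∘ to ∘ ∣ᵤ⇒∣ {+ p} {+ N}) (∣⇒∣ᵤ ∘ from ∘ ℤ.drop‿+<+)
    where open Equivalence (∣⇔0<val N-val)

open import Data.Nat.Divisibility using (m%n≡0⇒n∣m; n∣m⇒m%n≡0)
open import Data.Integer using (+_; 0ℤ)
import Data.Integer.Properties as ℤ
open import Data.List using ([]; _∷_)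
open import Data.List.Membership.Propositional using (_∈_)
open import Data.List.Relation.Unary.Any using (here; there)
open import Data.Product using (_,_; proj₁; proj₂)
open import Function using (_∘_; Equivalence)
import Data.Rational.Properties as ℚ
open import Relation.Binary.PropositionalEquality using (refl; ≢-sym)
open SquaresMod3 using (prime[3])
open IntegerValuations using (valuationℤ)
open Descent using (DistanceValuations; descent)
open Fractions
open RationalValuations

square-distance-valuations : (T x y X Y Z U : ℚ) → T ≢ ℚ.0ℚ → SquareConfig T x y X Y Z U →
  Σ ℤ λ k → Σ ℤ λ m →
    HasVal 3 X k × HasVal 3 Y k × HasVal 3 Z k × HasVal 3 U k × HasVal 3 T m × (k ℤ.< m)
square-distance-valuations T x y X Y Z U T≢0 config =
  + k ℤ.- + e , + m ℤ.- + e ,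
  HasVal-Numerator ⟦X⟧ D-val X-val , HasVal-Numerator ⟦Y⟧ D-val Y-val ,
  HasVal-Numerator ⟦Z⟧ D-val Z-val , HasVal-Numerator ⟦U⟧ D-val U-val ,
  HasVal-Numerator ⟦T⟧ D-val t-val , ℤ.+-monoˡ-< (ℤ.- + e) (ℤ.+<+ k<m)
  where
  qs = T ∷ x ∷ y ∷ X ∷ Y ∷ Z ∷ U ∷ []
  D = commonDenominator qs
  D≢0 = commonDenominator-≢0 qs
  ⟦_⟧ : ∀ {q} → q ∈ qs → Numerator D q (numeratorOver D q)
  ⟦ q∈qs ⟧ = numeratorOver-correct (↧ₙ∣commonDenominator q∈qs)
  ⟦T⟧ = ⟦ here refl ⟧
  ⟦x⟧ = ⟦ there (here refl) ⟧
  ⟦y⟧ = ⟦ there (there (here refl)) ⟧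
  ⟦X⟧ = ⟦ there (there (there (here refl))) ⟧
  ⟦Y⟧ = ⟦ there (there (there (there (here refl)))) ⟧
  ⟦Z⟧ = ⟦ there (there (there (there (there (here refl))))) ⟧
  ⟦U⟧ = ⟦ there (there (there (there (there (there (here refl)))))) ⟧
  open DistanceValuations
    (descent (SquareConfigℤ-numerators ⟦T⟧ ⟦x⟧ ⟦y⟧ ⟦X⟧ ⟦Y⟧ ⟦Z⟧ ⟦U⟧ config) (Numerator-≢0 ⟦T⟧ D≢0 T≢0))
  D-valuation = valuationℤ {3} {+ D} (D≢0 ∘ ℤ.+-injective)
  e = proj₁ D-valuation
  D-val = proj₂ D-valuation

primitive-valuations-mod-3 : ∀ {T X Y Z U k m} →
  ((p : ℕ) → Prime p → ¬ (p ∣ X × p ∣ Y × p ∣ Z × p ∣ T × p ∣ U)) →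
  HasVal 3 (ℕ→ℚ X) k → HasVal 3 (ℕ→ℚ Y) k → HasVal 3 (ℕ→ℚ Z) k → HasVal 3 (ℕ→ℚ U) k →
  HasVal 3 (ℕ→ℚ T) m → k ℤ.< m →
  (X % 3 ≢ 0) × (Y % 3 ≢ 0) × (Z % 3 ≢ 0) × (U % 3 ≢ 0) × (T % 3 ≡ 0)
primitive-valuations-mod-3 {T} {X} {Y} {Z} {U} {k} {m} coprime X-val Y-val Z-val U-val T-val k<m =
  3∤ X X-val , 3∤ Y Y-val , 3∤ Z Z-val , 3∤ U U-val ,
  n∣m⇒m%n≡0 T 3 (3∣T (ℤ.≤-<-trans (HasVal-ℕ-nonneg X prime[3] X-val) k<m))
  where
  open Equivalence
  3∣T : 0ℤ ℤ.< m → 3 ∣ T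
  3∣T = from (HasVal-ℕ-∣⇔ T prime[3] T-val)
  3∣all : 0ℤ ℤ.< k → 3 ∣ X × 3 ∣ Y × 3 ∣ Z × 3 ∣ T × 3 ∣ U
  3∣all 0<k = from (HasVal-ℕ-∣⇔ X prime[3] X-val) 0<k , from (HasVal-ℕ-∣⇔ Y prime[3] Y-val) 0<k ,
              from (HasVal-ℕ-∣⇔ Z prime[3] Z-val) 0<k , 3∣T (ℤ.<-trans 0<k k<m) ,
              from (HasVal-ℕ-∣⇔ U prime[3] U-val) 0<k
  3∤ : ∀ N → HasVal 3 (ℕ→ℚ N) k → N % 3 ≢ 0
  3∤ N N-val N%3≡0 = coprime 3 prime[3] (3∣all (to (HasVal-ℕ-∣⇔ N prime[3] N-val) (m%n≡0⇒n∣m N 3 N%3≡0)))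

proposition3p2 :
    ((T x y X Y Z U : ℚ) → ℚ.0ℚ ℚ.< T → SquareConfig T x y X Y Z U →
      Σ ℤ λ k → Σ ℤ λ m →
        HasVal 3 X k × HasVal 3 Y k × HasVal 3 Z k × HasVal 3 U k ×
        HasVal 3 T m × (k ℤ.< m))
    ×
    ((T X Y Z U : ℕ) → (x y : ℚ) → 0 ℕ.< T →
      SquareConfig (ℕ→ℚ T) x y (ℕ→ℚ X) (ℕ→ℚ Y) (ℕ→ℚ Z) (ℕ→ℚ U) →
      ((p : ℕ) → Prime p → ¬ (p ∣ X × p ∣ Y × p ∣ Z × p ∣ T × p ∣ U)) →
      (X % 3 ≢ 0) × (Y % 3 ≢ 0) × (Z % 3 ≢ 0) × (U % 3 ≢ 0) × (T % 3 ≡ 0))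
proposition3p2 =
  (λ T x y X Y Z U 0<T → square-distance-valuations T x y X Y Z U (≢-sym (ℚ.<⇒≢ 0<T))) ,
  λ T X Y Z U x y 0<T config coprime →
    let _ , _ , X-val , Y-val , Z-val , U-val , T-val , k<m =
          square-distance-valuations (ℕ→ℚ T) x y (ℕ→ℚ X) (ℕ→ℚ Y) (ℕ→ℚ Z) (ℕ→ℚ U) (ℕ→ℚ-≢0 0<T) config
    in primitive-valuations-mod-3 coprime X-val Y-val Z-val U-val T-val k<m
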